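{- Let $\mathcal{A}$ be an HDA satisfying conditions HM1, HM2 and HM3 with respect to a deterministic $\ltimes$-transition system $\mathcal{T}$ such that $\ltimes_\mathcal{T}$ is asymmetric. Let $v\in(P_\mathcal{A})_0$ and let $\alpha_1,\dots,\alpha_n\in\Sigma_\mathcal{A}$ with $n\ge2$. Then there exists at most one $x\in(P_\mathcal{A})_n$ such that $d^0_1\cdots d^0_nx=v$ and $\{\lambda_\mathcal{A}(d^0_1\cdots d^0_{i-1}d^0_{i+1}\cdots d^0_nx)\mid i\in\{1,\dots,n\}\}=\{\alpha_1,\dots,\alpha_n\}$.
   Context: A precubical set $P$ is a family of sets $(P_n)_{n\ge0}$ with face maps $d^k_i:P_n\to P_{n-1}$ ($n>0$, $k\in\{0,1\}$, $1\le i\le n$) satisfying $d^k_id^l_j=d^l_{j-1}d^k_i$ for $i<j$; composites of face maps are applied right to left. An HDA is $\mathcal{A}=(P_\mathcal{A},I_\mathcal{A},F_\mathcal{A},\Sigma_\mathcal{A},\lambda_\mathcal{A})$ with $P_\mathcal{A}$ a precubical set, $I_\mathcal{A}$ a vertex, $F_\mathcal{A}$ a set of vertices, $\lambda_\mathcal{A}:(P_\mathcal{A})_1\to\Sigma_\mathcal{A}$ with $\lambda_\mathcal{A}(d^0_iz)=\lambda_\mathcal{A}(d^1_iz)$ for 2-cubes $z$, $i=1,2$; $\mathcal{A}_{\le1}$ keeps cubes of degree $\le1$. A transition system is an HDA without cubes of degree $\ge2$ in which two edges with equal label, equal $d^0_1$ and equal $d^1_1$ coincide. A $\ltimes$-transition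 system $\mathcal{T}$ is a transition system $U(\mathcal{T})$ with a binary relation $\ltimes_\mathcal{T}$ on its label set; it is deterministic if any two edges with the same label and the same $d^0_1$ are equal; $\ltimes_\mathcal{T}$ asymmetric means $\alpha\ltimes_\mathcal{T}\beta$ implies not $\beta\ltimes_\mathcal{T}\alpha$. Conditions: (HM1) $\mathcal{A}_{\le1}=U(\mathcal{T})$; (HM2) for all $z\in(P_\mathcal{A})_2$, $\lambda_\mathcal{A}(d^0_2z)\ltimes_\mathcal{T}\lambda_\mathcal{A}(d^0_1z)$; (HM3) for all $m\ge2$ and $y,z\in(P_\mathcal{A})_m$, if $d^k_ry=d^k_rz$ for all $r\in\{1,\dots,m\}$, $k\in\{0,1\}$, then $y=z$. -}

module Defs where

open import Level using (Level; suc; _⊔_)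
open import Data.Nat as ℕ using (ℕ; zero; _≤_)
open import Data.Fin using (Fin; toℕ; fromℕ; inject₁; lower₁)
import Data.Fin as Fin
open import Data.Bool using (Bool; true; false)
open import Data.Empty using (⊥; ⊥-elim)
open import Data.Product using (Σ; ∃; _×_; _,_)
open import Function.Bundles using (_⇔_)
open import Relation.Binary.PropositionalEquality using (_≡_)
open import Relation.Nullary using (¬_; yes; no)
open import Data.Nat.Properties using (_≟_)

-- Face-map superscript k ∈ {0,1} is encoded as Bool: false = 0, true = 1.
-- Face-map subscript i ∈ {1,…,n+1} on (n+1)-cubes is encoded as Fin (suc n)
-- (Fin.zero ↔ 1, …, fromℕ n ↔ n+1).

record PrecubicalSet (ℓ : Level) : Set (suc ℓ) where
  field
    P : ℕ → Set ℓ
    d : (n : ℕ) → Bool → Fin (ℕ.suc n) → P (ℕ.suc n) → P n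
    -- d^k_i d^l_j = d^l_{j-1} d^k_i  for i < j  (j written as suc j', i ≤ j')
    cubical : (n : ℕ) (k l : Bool) (i j : Fin (ℕ.suc n)) → toℕ i ≤ toℕ j →
              (x : P (ℕ.suc (ℕ.suc n))) →
              d n k i (d (ℕ.suc n) l (Fin.suc j) x) ≡ d n l j (d (ℕ.suc n) k (inject₁ i) x)

record HDA (ℓ : Level) : Set (suc ℓ) where
  field
    cube  : PrecubicalSet ℓ
  open PrecubicalSet cube public
  field
    I     : P 0
    F     : P 0 → Set ℓ
    Lab   : Set ℓ
    label : P 1 → Lab
    label-faces : (z : P 2) (i : Fin 2) →
                  label (d 1 false i z) ≡ label (d 1 true i z)

truncP : ∀ {ℓ} → (ℕ → Set ℓ) → ℕ → Set ℓ
truncP P 0 = P 0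
truncP P 1 = P 1
truncP {ℓ} P (ℕ.suc (ℕ.suc n)) = Level.Lift ℓ ⊥

truncate : ∀ {ℓ} → HDA ℓ → HDA ℓ
truncate {ℓ} A = record
  { cube = record { P = truncP P ; d = d' ; cubical = λ n k l i j _ x → ⊥-elim (Level.lower x) }
  ; I = I ; F = F ; Lab = Lab ; label = label
  ; label-faces = λ z → ⊥-elim (Level.lower z) }
  where
  open HDA A
  d' : (n : ℕ) → Bool → Fin (ℕ.suc n) → truncP P (ℕ.suc n) → truncP P n
  d' zero k i x = d 0 k i x
  d' (ℕ.suc n) k i x = ⊥-elim (Level.lower x)

record IsTransitionSystem {ℓ} (T : HDA ℓ) : Set ℓ where
  open HDA T
  field
    no-higher : (n : ℕ) → ¬ P (ℕ.suc (ℕ.suc n))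
    edges-unique : (e e' : P 1) → label e ≡ label e' →
                   d 0 false Fin.zero e ≡ d 0 false Fin.zero e' →
                   d 0 true Fin.zero e ≡ d 0 true Fin.zero e' → e ≡ e'

Deterministic : ∀ {ℓ} → HDA ℓ → Set ℓ
Deterministic T = (e e' : HDA.P T 1) → HDA.label T e ≡ HDA.label T e' →
                  HDA.d T 0 false Fin.zero e ≡ HDA.d T 0 false Fin.zero e' → e ≡ e'

record ⋉TS (ℓ : Level) : Set (suc ℓ) where
  field
    U    : HDA ℓ
    isTS : IsTransitionSystem U
    _⋉_  : HDA.Lab U → HDA.Lab U → Set ℓ

Asymmetric : ∀ {ℓ} {A : Set ℓ} → (A → A → Set ℓ) → Set ℓ
Asymmetric _R_ = ∀ {a b} → a R b → ¬ (b R a)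

module _ {ℓ} (A : HDA ℓ) where
  open HDA A

  -- d^0_1 d^0_2 ⋯ d^0_n x  (d^0_n applied first)
  d0all : (n : ℕ) → P n → P 0
  d0all zero x = x
  d0all (ℕ.suc n) x = d0all n (d n false (fromℕ n) x)

  -- on P (j+1): d^0_1 ⋯ d^0_j y   (d^0_j applied first), leaving the last coordinate
  d0below : (j : ℕ) → P (ℕ.suc j) → P 1
  d0below zero y = y
  d0below (ℕ.suc j) y = d0below j (d (ℕ.suc j) false (inject₁ (fromℕ j)) y)

  -- for i ∈ {1..n} (encoded as Fin n):
  -- edge n i x = d^0_1 ⋯ d^0_{i-1} d^0_{i+1} ⋯ d^0_n x
  edge : (n : ℕ) → Fin n → P n → P 1
  edge (ℕ.suc n) i x with n ≟ toℕ i
  ... | yes _  = d0below n x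
  ... | no n≢i = edge n (lower₁ i n≢i) (d n false (fromℕ n) x)

HM2 : ∀ {ℓ} (A : HDA ℓ) → (HDA.Lab A → HDA.Lab A → Set ℓ) → Set ℓ
HM2 A _⋉_ = (z : P 2) → label (d 1 false (Fin.suc Fin.zero) z) ⋉ label (d 1 false Fin.zero z)
  where open HDA A

HM3 : ∀ {ℓ} (A : HDA ℓ) → Set ℓ
HM3 A = (m : ℕ) (y z : P (ℕ.suc (ℕ.suc m))) →
        ((r : Fin (ℕ.suc (ℕ.suc m))) (k : Bool) → d (ℕ.suc m) k r y ≡ d (ℕ.suc m) k r z) → y ≡ z
  where open HDA A

-- The edge labels of an n-cube x, read in the order of its directions, form a
-- strictly ⋉-increasing sequence: for two directions i < j some 2-dimensional
-- face of x spans exactly these directions, and HM2 compares its edges.  Since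
-- ⋉ is asymmetric, such a sequence is determined by its set of values, so two
-- cubes with the same source vertex and the same set of edge labels have the
-- same labelled edges.  By determinism these edges coincide, and induction on
-- the dimension using HM3 shows that the cubes coincide.
module Submission where

open import Defs
open import Data.Bool using (true; false)
open import Data.Empty using (⊥-elim)
open import Data.Fin using (Fin; zero; suc; toℕ; fromℕ; inject₁; punchIn; _≤_; _<_)
open import Data.Fin.Induction using (<-wellFounded)
open import Data.Fin.Properties
  using (toℕ-fromℕ; ≤fromℕ; toℕ-inject₁-≢; lower₁-inject₁′; <-cmp)
open import Data.Fin.Relation.Unary.Top using (view; ‵fromℕ; ‵inject₁)
open import Data.Nat using (ℕ; suc)
import Data.Nat as ℕ
open import Data.Nat.Properties using (_≟_; ≤-refl)
open import Data.Product using (∃; _,_)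
open import Function using (_∘_)
open import Function.Bundles using (_⇔_; Equivalence)
open import Induction.WellFounded using (module All)
open import Relation.Binary.Core using (Rel; _Preserves_⟶_)
open import Relation.Binary.Definitions using (tri<; tri≈; tri>)
open import Relation.Binary.PropositionalEquality
  using (_≡_; _≗_; refl; sym; trans; cong; subst; subst₂; module ≡-Reasoning)
open import Relation.Nullary using (¬_; yes; no; contradiction)

module _ {ℓ} {L : Set ℓ} {_⋉_ : Rel L ℓ} (⋉-asym : Asymmetric _⋉_) where

  strictlyMonotone-sameImage⇒≗ : ∀ {N} {s t : Fin N → L} →
    s Preserves _<_ ⟶ _⋉_ → t Preserves _<_ ⟶ _⋉_ →
    (∀ i → ∃ λ j → t j ≡ s i) → (∀ i → ∃ λ j → s j ≡ t i) → s ≗ t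
  strictlyMonotone-sameImage⇒≗ {s = s} {t} s-mono t-mono s⊆t t⊆s =
    All.wfRec <-wellFounded _ (λ i → s i ≡ t i) step
    where
    ⋉-irrefl : ∀ {x y} → x ≡ y → ¬ (x ⋉ y)
    ⋉-irrefl refl x⋉x = ⋉-asym x⋉x x⋉x

    step : ∀ i → (∀ {j} → j < i → s j ≡ t j) → s i ≡ t i
    step i ih with s⊆t i
    ... | k , tk≡si with <-cmp k i
    ...   | tri< k<i _ _ = contradiction (s-mono k<i) (⋉-irrefl (trans (ih k<i) tk≡si))
    ...   | tri≈ _ refl _ = sym tk≡si
    ...   | tri> _ _ i<k with t⊆s i
    ...     | l , sl≡ti with <-cmp l i
    ...       | tri< l<i _ _ = contradiction (t-mono l<i) (⋉-irrefl (trans (sym (ih l<i)) sl≡ti))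
    ...       | tri≈ _ refl _ = sl≡ti
    ...       | tri> _ _ i<l =
      ⊥-elim (⋉-asym (subst (s i ⋉_) sl≡ti (s-mono i<l)) (subst (t i ⋉_) tk≡si (t-mono i<k)))

punchIn-fromℕ : ∀ {n} (j : Fin n) → punchIn (fromℕ n) j ≡ inject₁ j
punchIn-fromℕ zero = refl
punchIn-fromℕ (suc j) = cong suc (punchIn-fromℕ j)

punchIn-inject₁-fromℕ : ∀ {n} (r : Fin (suc n)) → punchIn (inject₁ r) (fromℕ n) ≡ fromℕ (suc n)
punchIn-inject₁-fromℕ zero = refl
punchIn-inject₁-fromℕ {suc n} (suc r) = cong suc (punchIn-inject₁-fromℕ r)

punchIn-inject₁-inject₁ : ∀ {n} (r : Fin (suc n)) (j : Fin n) →
  punchIn (inject₁ r) (inject₁ j) ≡ inject₁ (punchIn r j)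
punchIn-inject₁-inject₁ zero j = refl
punchIn-inject₁-inject₁ (suc r) zero = refl
punchIn-inject₁-inject₁ (suc r) (suc j) = cong suc (punchIn-inject₁-inject₁ r j)

inject₁-≤-inject₁fromℕ : ∀ {n} (r : Fin (suc n)) → inject₁ r ≤ inject₁ (fromℕ n)
inject₁-≤-inject₁fromℕ zero = ℕ.z≤n
inject₁-≤-inject₁fromℕ {suc n} (suc r) = ℕ.s≤s (inject₁-≤-inject₁fromℕ r)

module _ {ℓ} (A : HDA ℓ) where
  open HDA A
  open ≡-Reasoning

  edge-fromℕ : ∀ n (x : P (suc n)) → edge A (suc n) (fromℕ n) x ≡ d0below A n x
  edge-fromℕ n x with n ≟ toℕ (fromℕ n)
  ... | yes _ = refl
  ... | no n≢n = contradiction (sym (toℕ-fromℕ n)) n≢n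

  edge-inject₁ : ∀ n (j : Fin (suc n)) (x : P (suc (suc n))) →
    edge A (suc (suc n)) (inject₁ j) x ≡ edge A (suc n) j (d (suc n) false (fromℕ (suc n)) x)
  edge-inject₁ n j x with suc n ≟ toℕ (inject₁ j)
  ... | yes n≡j = contradiction n≡j (toℕ-inject₁-≢ j)
  ... | no n≢j = cong (λ i → edge A (suc n) i (d (suc n) false (fromℕ (suc n)) x)) (lower₁-inject₁′ j n≢j)

  d0all-faceLast : ∀ n k (x : P (suc n)) → d0all A n (d n k (fromℕ n) x) ≡ d 0 k zero (d0below A n x)
  d0all-faceLast ℕ.zero k x = refl
  d0all-faceLast (suc n) k x = begin
    d0all A n (d n false (fromℕ n) (d (suc n) k (fromℕ (suc n)) x))
      ≡⟨ cong (d0all A n) (cubical n false k (fromℕ n) (fromℕ n) ≤-refl x) ⟩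
    d0all A n (d n k (fromℕ n) (d (suc n) false (inject₁ (fromℕ n)) x))
      ≡⟨ d0all-faceLast n k _ ⟩
    d 0 k zero (d0below A (suc n) x) ∎

  d0all-face₀ : ∀ n (r : Fin (suc n)) (x : P (suc n)) → d0all A n (d n false r x) ≡ d0all A (suc n) x
  d0all-face₀ n r x with view r
  ... | ‵fromℕ = refl
  d0all-face₀ (suc n) _ x | ‵inject₁ r = begin
    d0all A n (d n false (fromℕ n) (d (suc n) false (inject₁ r) x))
      ≡⟨ cong (d0all A n) (cubical n false false r (fromℕ n) (≤fromℕ r) x) ⟨
    d0all A n (d n false r (d (suc n) false (fromℕ (suc n)) x))
      ≡⟨ d0all-face₀ n r _ ⟩
    d0all A (suc (suc n)) x ∎

  source-edge : ∀ n (i : Fin (suc n)) (x : P (suc n)) → d 0 false zero (edge A (suc n) i x) ≡ d0all A (suc n) x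
  source-edge n i x with view i
  ... | ‵fromℕ = begin
    d 0 false zero (edge A (suc n) (fromℕ n) x) ≡⟨ cong (d 0 false zero) (edge-fromℕ n x) ⟩
    d 0 false zero (d0below A n x)              ≡⟨ d0all-faceLast n false x ⟨
    d0all A (suc n) x                           ∎
  source-edge (suc n) _ x | ‵inject₁ i = begin
    d 0 false zero (edge A (suc (suc n)) (inject₁ i) x)
      ≡⟨ cong (d 0 false zero) (edge-inject₁ n i x) ⟩
    d 0 false zero (edge A (suc n) i (d (suc n) false (fromℕ (suc n)) x))
      ≡⟨ source-edge n i _ ⟩
    d0all A (suc (suc n)) x ∎

  d0all-face₁ : ∀ n (r : Fin (suc n)) (x : P (suc n)) →
    d0all A n (d n true r x) ≡ d 0 true zero (edge A (suc n) r x)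
  d0all-face₁ n r x with view r
  ... | ‵fromℕ = begin
    d0all A n (d n true (fromℕ n) x)            ≡⟨ d0all-faceLast n true x ⟩
    d 0 true zero (d0below A n x)               ≡⟨ cong (d 0 true zero) (edge-fromℕ n x) ⟨
    d 0 true zero (edge A (suc n) (fromℕ n) x)  ∎
  d0all-face₁ (suc n) _ x | ‵inject₁ r = begin
    d0all A n (d n false (fromℕ n) (d (suc n) true (inject₁ r) x))
      ≡⟨ cong (d0all A n) (cubical n true false r (fromℕ n) (≤fromℕ r) x) ⟨
    d0all A n (d n true r (d (suc n) false (fromℕ (suc n)) x))
      ≡⟨ d0all-face₁ n r _ ⟩
    d 0 true zero (edge A (suc n) r (d (suc n) false (fromℕ (suc n)) x))
      ≡⟨ cong (d 0 true zero) (edge-inject₁ n r x) ⟨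
    d 0 true zero (edge A (suc (suc n)) (inject₁ r) x) ∎

  edgeLabel : ∀ n → Fin n → P n → Lab
  edgeLabel n i x = label (edge A n i x)

  -- label-faces propagated along d0below: the direction kept by d0below is never r,
  -- so the faces d^0_r x and d^k_r x contribute parallel edges.
  label-d0below-face : ∀ n k (r : Fin (suc (suc n))) → inject₁ (fromℕ n) ≤ r → (x : P (suc (suc n))) →
    label (d0below A n (d (suc n) k r x)) ≡ label (d0below A n (d (suc n) false r x))
  label-d0below-face ℕ.zero false r _ x = refl
  label-d0below-face ℕ.zero true r _ x = sym (label-faces x r)
  label-d0below-face (suc n) k (suc r) n<r x =
    trans (commuted k) (trans (label-d0below-face n k r n≤r _) (sym (commuted false)))
    where
    n≤r = ℕ.s≤s⁻¹ n<r
    commuted : ∀ k → label (d0below A (suc n) (d (suc (suc n)) k (suc r) x)) ≡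
      label (d0below A n (d (suc n) k r (d (suc (suc n)) false (inject₁ (inject₁ (fromℕ n))) x)))
    commuted k = cong (label ∘ d0below A n) (cubical (suc n) false k (inject₁ (fromℕ n)) r n≤r x)

  label-d0below-face-inject₁ : ∀ n k (r : Fin (suc n)) (x : P (suc (suc n))) →
    label (d0below A n (d (suc n) k (inject₁ r) x)) ≡ label (d0below A (suc n) x)
  label-d0below-face-inject₁ n k r x with view r
  ... | ‵fromℕ = label-d0below-face n k (inject₁ (fromℕ n)) ≤-refl x
  label-d0below-face-inject₁ (suc n) k _ x | ‵inject₁ r = begin
    label (d0below A n (d (suc n) false (inject₁ (fromℕ n)) (d (suc (suc n)) k (inject₁ (inject₁ r)) x)))
      ≡⟨ cong (label ∘ d0below A n) (cubical (suc n) k false (inject₁ r) (inject₁ (fromℕ n)) (inject₁-≤-inject₁fromℕ r) x) ⟨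
    label (d0below A n (d (suc n) k (inject₁ r) (d (suc (suc n)) false (inject₁ (fromℕ (suc n))) x)))
      ≡⟨ label-d0below-face-inject₁ n k r _ ⟩
    label (d0below A (suc (suc n)) x) ∎

  edgeLabel-faceLast : ∀ n k (j : Fin (suc n)) (x : P (suc (suc n))) →
    edgeLabel (suc n) j (d (suc n) k (fromℕ (suc n)) x) ≡ edgeLabel (suc n) j (d (suc n) false (fromℕ (suc n)) x)
  edgeLabel-faceLast n k j x with view j
  ... | ‵fromℕ = begin
    edgeLabel (suc n) (fromℕ n) (d (suc n) k (fromℕ (suc n)) x)
      ≡⟨ cong label (edge-fromℕ n _) ⟩
    label (d0below A n (d (suc n) k (fromℕ (suc n)) x))
      ≡⟨ label-d0below-face n k (fromℕ (suc n)) (≤fromℕ _) x ⟩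
    label (d0below A n (d (suc n) false (fromℕ (suc n)) x))
      ≡⟨ cong label (edge-fromℕ n _) ⟨
    edgeLabel (suc n) (fromℕ n) (d (suc n) false (fromℕ (suc n)) x) ∎
  edgeLabel-faceLast (suc n) k _ x | ‵inject₁ j =
    trans (commuted k) (trans (edgeLabel-faceLast n k j _) (sym (commuted false)))
    where
    commuted : ∀ k → edgeLabel (suc (suc n)) (inject₁ j) (d (suc (suc n)) k (fromℕ (suc (suc n))) x) ≡
      edgeLabel (suc n) j (d (suc n) k (fromℕ (suc n)) (d (suc (suc n)) false (inject₁ (fromℕ (suc n))) x))
    commuted k = begin
      edgeLabel (suc (suc n)) (inject₁ j) (d (suc (suc n)) k (fromℕ (suc (suc n))) x)
        ≡⟨ cong label (edge-inject₁ n j _) ⟩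
      edgeLabel (suc n) j (d (suc n) false (fromℕ (suc n)) (d (suc (suc n)) k (fromℕ (suc (suc n))) x))
        ≡⟨ cong (edgeLabel (suc n) j) (cubical (suc n) false k (fromℕ (suc n)) (fromℕ (suc n)) ≤-refl x) ⟩
      edgeLabel (suc n) j (d (suc n) k (fromℕ (suc n)) (d (suc (suc n)) false (inject₁ (fromℕ (suc n))) x)) ∎

  edgeLabel-face : ∀ n k (r : Fin (suc (suc n))) (j : Fin (suc n)) (x : P (suc (suc n))) →
    edgeLabel (suc n) j (d (suc n) k r x) ≡ edgeLabel (suc (suc n)) (punchIn r j) x
  edgeLabel-face n k r j x with view r
  ... | ‵fromℕ = begin
    edgeLabel (suc n) j (d (suc n) k (fromℕ (suc n)) x)     ≡⟨ edgeLabel-faceLast n k j x ⟩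
    edgeLabel (suc n) j (d (suc n) false (fromℕ (suc n)) x) ≡⟨ cong label (edge-inject₁ n j x) ⟨
    edgeLabel (suc (suc n)) (inject₁ j) x                   ≡⟨ cong (λ i → edgeLabel (suc (suc n)) i x) (punchIn-fromℕ j) ⟨
    edgeLabel (suc (suc n)) (punchIn (fromℕ (suc n)) j) x   ∎
  ... | ‵inject₁ r with view j
  ...   | ‵fromℕ = begin
    edgeLabel (suc n) (fromℕ n) (d (suc n) k (inject₁ r) x)   ≡⟨ cong label (edge-fromℕ n _) ⟩
    label (d0below A n (d (suc n) k (inject₁ r) x))           ≡⟨ label-d0below-face-inject₁ n k r x ⟩
    label (d0below A (suc n) x)                               ≡⟨ cong label (edge-fromℕ (suc n) x) ⟨
    edgeLabel (suc (suc n)) (fromℕ (suc n)) x                 ≡⟨ cong (λ i → edgeLabel (suc (suc n)) i x) (punchIn-inject₁-fromℕ r) ⟨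
    edgeLabel (suc (suc n)) (punchIn (inject₁ r) (fromℕ n)) x ∎
  edgeLabel-face (suc n) k _ _ x | ‵inject₁ r | ‵inject₁ j = begin
    edgeLabel (suc (suc n)) (inject₁ j) (d (suc (suc n)) k (inject₁ r) x)
      ≡⟨ cong label (edge-inject₁ n j _) ⟩
    edgeLabel (suc n) j (d (suc n) false (fromℕ (suc n)) (d (suc (suc n)) k (inject₁ r) x))
      ≡⟨ cong (edgeLabel (suc n) j) (cubical (suc n) k false r (fromℕ (suc n)) (≤fromℕ r) x) ⟨
    edgeLabel (suc n) j (d (suc n) k r (d (suc (suc n)) false (fromℕ (suc (suc n))) x))
      ≡⟨ edgeLabel-face n k r j _ ⟩
    edgeLabel (suc (suc n)) (punchIn r j) (d (suc (suc n)) false (fromℕ (suc (suc n))) x)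
      ≡⟨ cong label (edge-inject₁ (suc n) (punchIn r j) x) ⟨
    edgeLabel (suc (suc (suc n))) (inject₁ (punchIn r j)) x
      ≡⟨ cong (λ i → edgeLabel (suc (suc (suc n))) i x) (punchIn-inject₁-inject₁ r j) ⟨
    edgeLabel (suc (suc (suc n))) (punchIn (inject₁ r) (inject₁ j)) x ∎

  module _ (_⋉_ : Rel Lab ℓ) (hm2 : HM2 A _⋉_) where

    ⋉-through-face : ∀ n r (i j : Fin (suc (suc n))) (x : P (suc (suc (suc n)))) →
      edgeLabel (suc (suc n)) i (d (suc (suc n)) false r x) ⋉ edgeLabel (suc (suc n)) j (d (suc (suc n)) false r x) →
      edgeLabel (suc (suc (suc n))) (punchIn r i) x ⋉ edgeLabel (suc (suc (suc n))) (punchIn r j) x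
    ⋉-through-face n r i j x = subst₂ _⋉_ (edgeLabel-face (suc n) false r i x) (edgeLabel-face (suc n) false r j x)

    -- Directions i < j are compared on the face d^0_r x for some r ∉ {i, j}.
    edgeLabel-increasing : ∀ n (x : P (suc (suc n))) → (λ i → edgeLabel (suc (suc n)) i x) Preserves _<_ ⟶ _⋉_
    edgeLabel-increasing ℕ.zero x {zero} {suc zero} _ = hm2 x
    edgeLabel-increasing ℕ.zero x {suc zero} {suc zero} (ℕ.s≤s ())
    edgeLabel-increasing (suc n) x {suc i} {suc j} i<j =
      ⋉-through-face n zero i j x (edgeLabel-increasing n _ (ℕ.s<s⁻¹ i<j))
    edgeLabel-increasing (suc n) x {zero} {suc zero} _ =
      ⋉-through-face n (suc (suc zero)) zero (suc zero) x (edgeLabel-increasing n _ ℕ.z<s)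
    edgeLabel-increasing (suc n) x {zero} {suc (suc j)} _ =
      ⋉-through-face n (suc zero) zero (suc j) x (edgeLabel-increasing n _ ℕ.z<s)

  module _ (det : Deterministic (truncate A)) (hm3 : HM3 A) where

    sameSource-sameLabel⇒edge≡ : ∀ n (i : Fin (suc n)) (x y : P (suc n)) →
      d0all A (suc n) x ≡ d0all A (suc n) y → edgeLabel (suc n) i x ≡ edgeLabel (suc n) i y →
      edge A (suc n) i x ≡ edge A (suc n) i y
    sameSource-sameLabel⇒edge≡ n i x y x₀≡y₀ label≡ = det _ _ label≡ (begin
      d 0 false zero (edge A (suc n) i x) ≡⟨ source-edge n i x ⟩
      d0all A (suc n) x                   ≡⟨ x₀≡y₀ ⟩
      d0all A (suc n) y                   ≡⟨ source-edge n i y ⟨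
      d 0 false zero (edge A (suc n) i y) ∎)

    sameSource-sameEdgeLabels⇒≡ : ∀ n (x y : P (suc n)) → d0all A (suc n) x ≡ d0all A (suc n) y →
      (∀ i → edgeLabel (suc n) i x ≡ edgeLabel (suc n) i y) → x ≡ y
    sameSource-sameEdgeLabels⇒≡ ℕ.zero x y x₀≡y₀ labels≡ = det x y (labels≡ zero) x₀≡y₀
    sameSource-sameEdgeLabels⇒≡ (suc n) x y x₀≡y₀ labels≡ =
      hm3 n x y λ r k → sameSource-sameEdgeLabels⇒≡ n _ _ (faces-source r k) (faces-labels r k)
      where
      faces-source : ∀ r k → d0all A (suc n) (d (suc n) k r x) ≡ d0all A (suc n) (d (suc n) k r y)
      faces-source r false = begin
        d0all A (suc n) (d (suc n) false r x) ≡⟨ d0all-face₀ (suc n) r x ⟩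
        d0all A (suc (suc n)) x               ≡⟨ x₀≡y₀ ⟩
        d0all A (suc (suc n)) y               ≡⟨ d0all-face₀ (suc n) r y ⟨
        d0all A (suc n) (d (suc n) false r y) ∎
      faces-source r true = begin
        d0all A (suc n) (d (suc n) true r x)          ≡⟨ d0all-face₁ (suc n) r x ⟩
        d 0 true zero (edge A (suc (suc n)) r x)
          ≡⟨ cong (d 0 true zero) (sameSource-sameLabel⇒edge≡ (suc n) r x y x₀≡y₀ (labels≡ r)) ⟩
        d 0 true zero (edge A (suc (suc n)) r y)      ≡⟨ d0all-face₁ (suc n) r y ⟨
        d0all A (suc n) (d (suc n) true r y)          ∎
      faces-labels : ∀ r k i → edgeLabel (suc n) i (d (suc n) k r x) ≡ edgeLabel (suc n) i (d (suc n) k r y)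
      faces-labels r k i = begin
        edgeLabel (suc n) i (d (suc n) k r x)     ≡⟨ edgeLabel-face n k r i x ⟩
        edgeLabel (suc (suc n)) (punchIn r i) x   ≡⟨ labels≡ (punchIn r i) ⟩
        edgeLabel (suc (suc n)) (punchIn r i) y   ≡⟨ edgeLabel-face n k r i y ⟨
        edgeLabel (suc n) i (d (suc n) k r y)     ∎

theorem4p9 : ∀ {ℓ} (A : HDA ℓ) (_⋉_ : HDA.Lab A → HDA.Lab A → Set ℓ) →
    -- 𝒯 is the ⋉-transition system with U(𝒯) = 𝒜_{≤1} (HM1) and relation ⋉
    IsTransitionSystem (truncate A) →
    Deterministic (truncate A) →
    Asymmetric _⋉_ →
    HM2 A _⋉_ →
    HM3 A →
    (v : HDA.P A 0) (m : ℕ) (α : Fin (suc (suc m)) → HDA.Lab A) →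
    (x y : HDA.P A (suc (suc m))) →
    d0all A (suc (suc m)) x ≡ v →
    (∀ a → (∃ λ i → HDA.label A (edge A (suc (suc m)) i x) ≡ a) ⇔ (∃ λ j → α j ≡ a)) →
    d0all A (suc (suc m)) y ≡ v →
    (∀ a → (∃ λ i → HDA.label A (edge A (suc (suc m)) i y) ≡ a) ⇔ (∃ λ j → α j ≡ a)) →
    x ≡ y
theorem4p9 A _⋉_ _ det ⋉-asym hm2 hm3 v m α x y x₀≡v labelsˣ y₀≡v labelsʸ =
  sameSource-sameEdgeLabels⇒≡ A det hm3 (suc m) x y (trans x₀≡v (sym y₀≡v))
    (strictlyMonotone-sameImage⇒≗ {_⋉_ = _⋉_} ⋉-asym
      (edgeLabel-increasing A _⋉_ hm2 m x) (edgeLabel-increasing A _⋉_ hm2 m y)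
      (image⊆ labelsˣ labelsʸ) (image⊆ labelsʸ labelsˣ))
  where
  image⊆ : ∀ {s t : Fin (suc (suc m)) → HDA.Lab A} →
    (∀ a → (∃ λ i → s i ≡ a) ⇔ (∃ λ j → α j ≡ a)) → (∀ a → (∃ λ i → t i ≡ a) ⇔ (∃ λ j → α j ≡ a)) →
    ∀ i → ∃ λ k → t k ≡ s i
  image⊆ {s} s≈α t≈α i = Equivalence.from (t≈α (s i)) (Equivalence.to (s≈α (s i)) (i , refl))
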